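{- Let $N\ge 2$ and $n\ge 1$ be integers. Then $$ c_{N,n}=\sum_{m=0}^{n}\left(\frac{N}{1-N}\right)^m\sum_{0\le i_m<\cdots<i_1<i_0=n}\frac{n!}{i_m!}\,c_{N-1,i_m}\prod_{k=1}^m\frac{c_{N-1,\,i_{k-1}-i_k+1}}{(i_{k-1}-i_k+1)!}, $$ where the inner sum runs over integers $i_1,\dots,i_m$ with $0\le i_m<\cdots<i_1<i_0$, and $i_0=n$ (for $m=0$ the inner sum consists of the single term $c_{N-1,n}$, the product being empty).
   Context: For a positive integer $N$, the hypergeometric Cauchy numbers $c_{N,n}$ ($n\ge 0$) are defined by the formal power series identity $$\frac{1}{{}_2F_1(1,N;N+1;-x)}=\frac{(-1)^{N-1}x^N/N}{\log(1+x)-\sum_{k=1}^{N-1}(-1)^{k-1}x^k/k}=\sum_{n=0}^\infty c_{N,n}\frac{x^n}{n!},$$ where ${}_2F_1(a,b;c;z)=\sum_{n\ge0}\frac{(a)^{(n)}(b)^{(n)}}{(c)^{(n)}}\frac{z^n}{n!}$ is the Gauss hypergeometric function and $(x)^{(n)}=x(x+1)\cdots(x+n-1)$, $(x)^{(0)}=1$. In particular $c_{N,0}=1$. -}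

module Defs where

import Data.Nat as ℕ
open ℕ using (ℕ; zero; suc; _!; _∸_)
open import Data.Integer as ℤ using (ℤ)
import Data.Rational as ℚ
open ℚ using (ℚ; 0ℚ; 1ℚ; _+_; _*_; -_; _÷_; _≟_; ≢-nonZero)
open import Data.List using (List; []; _∷_; map; foldr; upTo; concatMap)
open import Relation.Nullary using (yes; no)

ℕtoℚ : ℕ → ℚ
ℕtoℚ n = ℤ.+ n ℚ./ 1

-- total division on ℚ (p ÷' 0 = 0); only ever applied to nonzero divisors below
_÷'_ : ℚ → ℚ → ℚ
p ÷' q with q ≟ 0ℚ
... | yes _ = 0ℚ
... | no q≢0 = _÷_ p q {{≢-nonZero q≢0}}

_^ℚ_ : ℚ → ℕ → ℚ
p ^ℚ zero = 1ℚ
p ^ℚ suc m = p * (p ^ℚ m)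

rising : ℕ → ℕ → ℕ
rising x zero = 1
rising x (suc n) = rising x n ℕ.* (x ℕ.+ n)

sumℚ : List ℚ → ℚ
sumℚ = foldr _+_ 0ℚ

sumTo : ℕ → (ℕ → ℚ) → ℚ
sumTo n f = sumℚ (map f (upTo n))

F21coeff : ℕ → ℕ → ℕ → ℕ → ℚ
F21coeff a b c n =
  ℕtoℚ (rising a n ℕ.* rising b n) ÷' ℕtoℚ (rising c n ℕ.* (n !))

-- coefficient of x^n in 2F1(1,N;N+1;-x)
hypCoeff : ℕ → ℕ → ℚ
hypCoeff N n = F21coeff 1 N (suc N) n * ((- 1ℚ) ^ℚ n)

-- coefficients d_0..d_n (as a list, d_n first) of the multiplicative inverse 1/A(x)
-- of a formal power series A(x) = Σ a_k x^k, given a_0 ≠ 0: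
-- d_0 = 1/a_0,  d_n = -(1/a_0) Σ_{k=1}^{n} a_k d_{n-k}
invList : (ℕ → ℚ) → ℕ → List ℚ
invList a zero = (1ℚ ÷' a 0) ∷ []
invList a (suc n) = (- (conv 1 ds) ÷' a 0) ∷ ds
  where
  ds = invList a n
  conv : ℕ → List ℚ → ℚ    -- Σ a_k d_{n+1-k}, k = 1..n+1
  conv k [] = 0ℚ
  conv k (d ∷ rest) = a k * d + conv (suc k) rest

invCoeff : (ℕ → ℚ) → ℕ → ℚ
invCoeff a n with invList a n
... | d ∷ _ = d
... | [] = 0ℚ

-- hypergeometric Cauchy numbers: 1/2F1(1,N;N+1;-x) = Σ c_{N,n} x^n / n!
c : ℕ → ℕ → ℚ
c N n = ℕtoℚ (n !) * invCoeff (hypCoeff N) n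

-- all lists [i_1, ..., i_m] with i > i_1 > i_2 > ... > i_m ≥ 0
decChains : ℕ → ℕ → List (List ℕ)
decChains zero i = [] ∷ []
decChains (suc m) i = concatMap (λ j → map (j ∷_) (decChains m j)) (upTo i)

-- summand for a chain: with i_0 = n, prev = i_{k-1}, list = [i_k,...,i_m]:
-- (n!/i_m!) c_{N-1,i_m} Π_k c_{N-1,i_{k-1}-i_k+1}/(i_{k-1}-i_k+1)!
chainTerm : ℕ → ℕ → ℕ → List ℕ → ℚ
chainTerm N n prev [] = (ℕtoℚ (n !) ÷' ℕtoℚ (prev !)) * c (N ∸ 1) prev
chainTerm N n prev (j ∷ l) =
  (c (N ∸ 1) (prev ∸ j ℕ.+ 1) ÷' ℕtoℚ ((prev ∸ j ℕ.+ 1) !)) * chainTerm N n j l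

rhs : ℕ → ℕ → ℚ
rhs N n = sumTo (suc n) (λ m →
  ((ℕtoℚ N ÷' (1ℚ ℚ.- ℕtoℚ N)) ^ℚ m)
    * sumℚ (map (chainTerm N n n) (decChains m n)))

-- Let a = ₂F₁(1,N−1;N;−x), b = 1/a and ρ = N/(1−N). Comparing coefficients,
-- ₂F₁(1,N;N+1;−x) = ρ (a − 1)/x, and ρ b₁ = −1. Writing b = 1 + b₁x + x h,
-- one gets a − 1 = (1 − b)/b = −x(b₁ + h)/b, hence
--   1/₂F₁(1,N;N+1;−x) = b/(1 − ρ h) = Σₘ ρᵐ b hᵐ,
-- and expanding b hᵐ coefficientwise gives the sum over chains iₘ < ⋯ < i₁ < n.
-- Formally, S = Σₘ ρᵐ b hᵐ satisfies S = b + ρ S h, and one checks that the series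
-- U = ρ (a − 1)/x · S − 1 obeys U = ρ U h; as h₀ = 0 this forces U = 0.

module Submission where

open import Defs
open import Data.Nat as ℕ using (ℕ; zero; suc; _!; _∸_; _≤_; _<_; z≤n; s≤s)
open import Data.Nat.Properties using (_!≢0)
import Data.Nat.Properties as ℕ
open import Data.Nat.Induction using (<-rec)
import Data.Nat.Tactic.RingSolver as ℕ-Solver
import Data.Integer as ℤ
import Data.Integer.Properties as ℤ
open import Data.Rational as ℚ
  using (ℚ; 0ℚ; 1ℚ; _+_; _*_; -_; _-_; 1/_; toℚᵘ; ≢-nonZero)
open import Data.Rational.Properties
  using (+-*-commutativeRing; neg-injective; *-comm; +-identityˡ; +-identityʳ; +-assoc;
         *-identityˡ; *-identityʳ; *-zeroˡ; *-zeroʳ; *-assoc; *-distribˡ-+; *-distribʳ-+;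
         *-inverseʳ; *-inverseˡ;
         toℚᵘ-injective; toℚᵘ-homo-+; toℚᵘ-homo-*; toℚᵘ-fromℚᵘ; toℚᵘ-cong)
import Data.Rational.Unnormalised as ℚᵘ
import Data.Rational.Unnormalised.Properties as ℚᵘ
open import Data.Empty using (⊥-elim)
open import Data.Maybe using (Maybe; just; nothing)
open import Data.List using (List; []; _∷_; _++_; map; concatMap; applyUpTo; upTo)
open import Data.List.Properties using (map-∘; map-cong; map-++)
open import Function using (_∘_)
open import Relation.Nullary using (yes; no)
open import Relation.Binary.PropositionalEquality
import Tactic.RingSolver.Core.AlmostCommutativeRing as ACR
open import Tactic.RingSolver using (solve-∀)

ℚ-ring : ACR.AlmostCommutativeRing _ _
ℚ-ring = ACR.fromCommutativeRing +-*-commutativeRing isZero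
  where
  isZero : (x : ℚ) → Maybe (0ℚ ≡ x)
  isZero x with 0ℚ ℚ.≟ x
  ... | yes p = just p
  ... | no _ = nothing

ℕtoℚ-toℚᵘ : ∀ n → toℚᵘ (ℕtoℚ n) ℚᵘ.≃ ℚᵘ.mkℚᵘ (ℤ.+ n) 0
ℕtoℚ-toℚᵘ n = toℚᵘ-fromℚᵘ (ℚᵘ.mkℚᵘ (ℤ.+ n) 0)

ℕtoℚ-homo-+ : ∀ m n → ℕtoℚ (m ℕ.+ n) ≡ ℕtoℚ m + ℕtoℚ n
ℕtoℚ-homo-+ m n = toℚᵘ-injective (begin
  toℚᵘ (ℕtoℚ (m ℕ.+ n))              ≈⟨ ℕtoℚ-toℚᵘ (m ℕ.+ n) ⟩
  ℚᵘ.mkℚᵘ (ℤ.+ (m ℕ.+ n)) 0          ≈⟨ ℚᵘ.*≡* (cong (ℤ._* ℤ.+ 1) +-numerator) ⟩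
  ℚᵘ.mkℚᵘ (ℤ.+ m) 0 ℚᵘ.+ ℚᵘ.mkℚᵘ (ℤ.+ n) 0
                                      ≈⟨ ℚᵘ.+-cong (ℕtoℚ-toℚᵘ m) (ℕtoℚ-toℚᵘ n) ⟨
  toℚᵘ (ℕtoℚ m) ℚᵘ.+ toℚᵘ (ℕtoℚ n)   ≈⟨ toℚᵘ-homo-+ (ℕtoℚ m) (ℕtoℚ n) ⟨
  toℚᵘ (ℕtoℚ m + ℕtoℚ n)             ∎)
  where
  open ℚᵘ.≃-Reasoning
  +-numerator : ℤ.+ (m ℕ.+ n) ≡ ℤ.+ m ℤ.* ℤ.+ 1 ℤ.+ ℤ.+ n ℤ.* ℤ.+ 1
  +-numerator = trans (ℤ.pos-+ m n) (sym (cong₂ ℤ._+_ (ℤ.*-identityʳ (ℤ.+ m)) (ℤ.*-identityʳ (ℤ.+ n))))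

ℕtoℚ-homo-* : ∀ m n → ℕtoℚ (m ℕ.* n) ≡ ℕtoℚ m * ℕtoℚ n
ℕtoℚ-homo-* m n = toℚᵘ-injective (begin
  toℚᵘ (ℕtoℚ (m ℕ.* n))              ≈⟨ ℕtoℚ-toℚᵘ (m ℕ.* n) ⟩
  ℚᵘ.mkℚᵘ (ℤ.+ (m ℕ.* n)) 0          ≈⟨ ℚᵘ.*≡* (cong (ℤ._* ℤ.+ 1) (ℤ.pos-* m n)) ⟩
  ℚᵘ.mkℚᵘ (ℤ.+ m) 0 ℚᵘ.* ℚᵘ.mkℚᵘ (ℤ.+ n) 0
                                      ≈⟨ ℚᵘ.*-cong (ℕtoℚ-toℚᵘ m) (ℕtoℚ-toℚᵘ n) ⟨
  toℚᵘ (ℕtoℚ m) ℚᵘ.* toℚᵘ (ℕtoℚ n)   ≈⟨ toℚᵘ-homo-* (ℕtoℚ m) (ℕtoℚ n) ⟨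
  toℚᵘ (ℕtoℚ m * ℕtoℚ n)             ∎)
  where open ℚᵘ.≃-Reasoning

ℕtoℚ-≢0 : ∀ n .{{_ : ℕ.NonZero n}} → ℕtoℚ n ≢ 0ℚ
ℕtoℚ-≢0 (suc n) eq with ℚᵘ.≃-trans (ℚᵘ.≃-sym (ℕtoℚ-toℚᵘ (suc n))) (toℚᵘ-cong eq)
... | ℚᵘ.*≡* ()

÷'-≡-*1/ : ∀ p {q} (q≢0 : q ≢ 0ℚ) → p ÷' q ≡ p * (1/ q) {{≢-nonZero q≢0}}
÷'-≡-*1/ p {q} q≢0 with q ℚ.≟ 0ℚ
... | yes q≡0 = ⊥-elim (q≢0 q≡0)
... | no _ = refl

p÷'q*q≡p : ∀ p {q} → q ≢ 0ℚ → (p ÷' q) * q ≡ p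
p÷'q*q≡p p {q} q≢0 = begin
  (p ÷' q) * q      ≡⟨ cong (_* q) (÷'-≡-*1/ p q≢0) ⟩
  (p * 1/q) * q     ≡⟨ *-assoc p 1/q q ⟩
  p * (1/q * q)     ≡⟨ cong (p *_) (*-inverseˡ q {{≢-nonZero q≢0}}) ⟩
  p * 1ℚ            ≡⟨ *-identityʳ p ⟩
  p                 ∎
  where
  open ≡-Reasoning
  1/q = (1/ q) {{≢-nonZero q≢0}}

÷'-unique : ∀ {p q} z → q ≢ 0ℚ → z * q ≡ p → p ÷' q ≡ z
÷'-unique {p} {q} z q≢0 z*q≡p = begin
  p ÷' q            ≡⟨ cong (_÷' q) z*q≡p ⟨
  (z * q) ÷' q      ≡⟨ ÷'-≡-*1/ (z * q) q≢0 ⟩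
  (z * q) * 1/q     ≡⟨ *-assoc z q 1/q ⟩
  z * (q * 1/q)     ≡⟨ cong (z *_) (*-inverseʳ q {{≢-nonZero q≢0}}) ⟩
  z * 1ℚ            ≡⟨ *-identityʳ z ⟩
  z                 ∎
  where
  open ≡-Reasoning
  1/q = (1/ q) {{≢-nonZero q≢0}}

÷'-cross : ∀ {p q r s} → q ≢ 0ℚ → s ≢ 0ℚ → p * s ≡ r * q → p ÷' q ≡ r ÷' s
÷'-cross {p} {q} {r} {s} q≢0 s≢0 ps≡rq = ÷'-unique (r ÷' s) q≢0 (begin
  (r ÷' s) * q      ≡⟨ cong (_* q) (÷'-≡-*1/ r s≢0) ⟩
  (r * 1/s) * q     ≡⟨ swap r 1/s q ⟩
  (r * q) * 1/s     ≡⟨ cong (_* 1/s) ps≡rq ⟨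
  (p * s) * 1/s     ≡⟨ *-assoc p s 1/s ⟩
  p * (s * 1/s)     ≡⟨ cong (p *_) (*-inverseʳ s {{≢-nonZero s≢0}}) ⟩
  p * 1ℚ            ≡⟨ *-identityʳ p ⟩
  p                 ∎)
  where
  open ≡-Reasoning
  1/s = (1/ s) {{≢-nonZero s≢0}}
  swap : ∀ x y z → (x * y) * z ≡ (x * z) * y
  swap = solve-∀ ℚ-ring

p÷'1≡p : ∀ p → p ÷' 1ℚ ≡ p
p÷'1≡p p = ÷'-unique p (λ ()) (*-identityʳ p)

sumBelow : ℕ → (ℕ → ℚ) → ℚ
sumBelow zero f = 0ℚ
sumBelow (suc L) f = f 0 + sumBelow L (f ∘ suc)

sumBelow-cong : ∀ L {f g} → (∀ k → k < L → f k ≡ g k) → sumBelow L f ≡ sumBelow L g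
sumBelow-cong zero f≡g = refl
sumBelow-cong (suc L) f≡g = cong₂ _+_ (f≡g 0 (s≤s z≤n)) (sumBelow-cong L (λ k k<L → f≡g (suc k) (s≤s k<L)))

sumBelow-zero : ∀ L {f} → (∀ k → k < L → f k ≡ 0ℚ) → sumBelow L f ≡ 0ℚ
sumBelow-zero zero f≡0 = refl
sumBelow-zero (suc L) f≡0 = trans (cong₂ _+_ (f≡0 0 (s≤s z≤n)) (sumBelow-zero L (λ k k<L → f≡0 (suc k) (s≤s k<L)))) (+-identityʳ 0ℚ)

sumBelow-suc-last : ∀ L f → sumBelow (suc L) f ≡ sumBelow L f + f L
sumBelow-suc-last zero f = trans (+-identityʳ (f 0)) (sym (+-identityˡ (f 0)))
sumBelow-suc-last (suc L) f = trans (cong (f 0 +_) (sumBelow-suc-last L (f ∘ suc))) (sym (+-assoc (f 0) _ _))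

sumBelow-+ : ∀ K L f → sumBelow (K ℕ.+ L) f ≡ sumBelow K f + sumBelow L (λ m → f (K ℕ.+ m))
sumBelow-+ zero L f = sym (+-identityˡ _)
sumBelow-+ (suc K) L f = trans (cong (f 0 +_) (sumBelow-+ K L (f ∘ suc))) (sym (+-assoc (f 0) _ _))

*-distribˡ-sumBelow : ∀ L s f → s * sumBelow L f ≡ sumBelow L (λ k → s * f k)
*-distribˡ-sumBelow zero s f = *-zeroʳ s
*-distribˡ-sumBelow (suc L) s f = trans (*-distribˡ-+ s (f 0) _) (cong (s * f 0 +_) (*-distribˡ-sumBelow L s (f ∘ suc)))

sumℚ-++ : ∀ xs ys → sumℚ (xs ++ ys) ≡ sumℚ xs + sumℚ ys
sumℚ-++ [] ys = sym (+-identityˡ _)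
sumℚ-++ (x ∷ xs) ys = trans (cong (x +_) (sumℚ-++ xs ys)) (sym (+-assoc x _ _))

sumℚ-map-concatMap : ∀ {A B : Set} (f : B → ℚ) (g : A → List B) xs →
  sumℚ (map f (concatMap g xs)) ≡ sumℚ (map (λ x → sumℚ (map f (g x))) xs)
sumℚ-map-concatMap f g [] = refl
sumℚ-map-concatMap f g (x ∷ xs) = begin
  sumℚ (map f (g x ++ concatMap g xs))                ≡⟨ cong sumℚ (map-++ f (g x) _) ⟩
  sumℚ (map f (g x) ++ map f (concatMap g xs))        ≡⟨ sumℚ-++ (map f (g x)) _ ⟩
  sumℚ (map f (g x)) + sumℚ (map f (concatMap g xs))  ≡⟨ cong (sumℚ (map f (g x)) +_) (sumℚ-map-concatMap f g xs) ⟩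
  sumℚ (map f (g x)) + sumℚ (map (λ y → sumℚ (map f (g y))) xs) ∎
  where open ≡-Reasoning

*-distribˡ-sumℚ-map : ∀ {A : Set} s (f : A → ℚ) xs → s * sumℚ (map f xs) ≡ sumℚ (map (λ x → s * f x) xs)
*-distribˡ-sumℚ-map s f [] = *-zeroʳ s
*-distribˡ-sumℚ-map s f (x ∷ xs) = trans (*-distribˡ-+ s (f x) _) (cong (s * f x +_) (*-distribˡ-sumℚ-map s f xs))

sumℚ-map-applyUpTo : ∀ {A : Set} (f : A → ℚ) g L → sumℚ (map f (applyUpTo g L)) ≡ sumBelow L (f ∘ g)
sumℚ-map-applyUpTo f g zero = refl
sumℚ-map-applyUpTo f g (suc L) = cong (f (g 0) +_) (sumℚ-map-applyUpTo f (g ∘ suc) L)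

sumTo≡sumBelow : ∀ L f → sumTo L f ≡ sumBelow L f
sumTo≡sumBelow L f = sumℚ-map-applyUpTo f (λ k → k) L

Series : Set
Series = ℕ → ℚ

tail : Series → Series
tail f = f ∘ suc

𝟘 𝟙 : Series
𝟘 _ = 0ℚ
𝟙 zero = 1ℚ
𝟙 (suc _) = 0ℚ

infixl 6 _⊕_
infixr 8 _∙_
infixl 7 _⋆_

_⊕_ : Series → Series → Series
(f ⊕ g) k = f k + g k

_∙_ : ℚ → Series → Series
(s ∙ f) k = s * f k

_⋆_ : Series → Series → Series
(f ⋆ g) zero = f 0 * g 0
(f ⋆ g) (suc n) = f 0 * g (suc n) + (tail f ⋆ g) n

⋆-cong : ∀ {f f′ g g′} → f ≗ f′ → g ≗ g′ → f ⋆ g ≗ f′ ⋆ g′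
⋆-cong f≗f′ g≗g′ zero = cong₂ _*_ (f≗f′ 0) (g≗g′ 0)
⋆-cong f≗f′ g≗g′ (suc n) = cong₂ _+_ (cong₂ _*_ (f≗f′ 0) (g≗g′ (suc n))) (⋆-cong (f≗f′ ∘ suc) g≗g′ n)

⋆-congˡ-≤ : ∀ {f f′} g n → (∀ k → k ≤ n → f k ≡ f′ k) → (f ⋆ g) n ≡ (f′ ⋆ g) n
⋆-congˡ-≤ g zero f≡f′ = cong (_* g 0) (f≡f′ 0 z≤n)
⋆-congˡ-≤ g (suc n) f≡f′ = cong₂ _+_ (cong (_* g (suc n)) (f≡f′ 0 z≤n)) (⋆-congˡ-≤ g n (λ k k≤n → f≡f′ (suc k) (s≤s k≤n)))

⋆-congʳ-≤ : ∀ f {g g′} n → (∀ k → k ≤ n → g k ≡ g′ k) → (f ⋆ g) n ≡ (f ⋆ g′) n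
⋆-congʳ-≤ f zero g≡g′ = cong (f 0 *_) (g≡g′ 0 z≤n)
⋆-congʳ-≤ f (suc n) g≡g′ = cong₂ _+_ (cong (f 0 *_) (g≡g′ (suc n) ℕ.≤-refl)) (⋆-congʳ-≤ (tail f) n (λ k k≤n → g≡g′ k (ℕ.m≤n⇒m≤1+n k≤n)))

⋆-distribʳ-⊕ : ∀ f g h → (f ⊕ g) ⋆ h ≗ f ⋆ h ⊕ g ⋆ h
⋆-distribʳ-⊕ f g h zero = *-distribʳ-+ (h 0) (f 0) (g 0)
⋆-distribʳ-⊕ f g h (suc n) = trans (cong ((f 0 + g 0) * h (suc n) +_) (⋆-distribʳ-⊕ (tail f) (tail g) h n)) (interchange (f 0) (g 0) (h (suc n)) _ _)
  where
  interchange : ∀ a b c d e → (a + b) * c + (d + e) ≡ (a * c + d) + (b * c + e)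
  interchange = solve-∀ ℚ-ring

⋆-distribˡ-⊕ : ∀ f g h → f ⋆ (g ⊕ h) ≗ f ⋆ g ⊕ f ⋆ h
⋆-distribˡ-⊕ f g h zero = *-distribˡ-+ (f 0) (g 0) (h 0)
⋆-distribˡ-⊕ f g h (suc n) = trans (cong (f 0 * (g (suc n) + h (suc n)) +_) (⋆-distribˡ-⊕ (tail f) g h n)) (interchange (f 0) (g (suc n)) (h (suc n)) _ _)
  where
  interchange : ∀ a b c d e → a * (b + c) + (d + e) ≡ (a * b + d) + (a * c + e)
  interchange = solve-∀ ℚ-ring

∙-⋆-assoc : ∀ s f h → (s ∙ f) ⋆ h ≗ s ∙ (f ⋆ h)
∙-⋆-assoc s f h zero = *-assoc s (f 0) (h 0)
∙-⋆-assoc s f h (suc n) = trans (cong ((s * f 0) * h (suc n) +_) (∙-⋆-assoc s (tail f) h n)) (factor s (f 0) (h (suc n)) _)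
  where
  factor : ∀ s a b c → (s * a) * b + s * c ≡ s * (a * b + c)
  factor = solve-∀ ℚ-ring

⋆-∙-comm : ∀ s f h → f ⋆ (s ∙ h) ≗ s ∙ (f ⋆ h)
⋆-∙-comm s f h zero = swap (f 0) s (h 0)
  where
  swap : ∀ a s b → a * (s * b) ≡ s * (a * b)
  swap = solve-∀ ℚ-ring
⋆-∙-comm s f h (suc n) = trans (cong (f 0 * (s * h (suc n)) +_) (⋆-∙-comm s (tail f) h n)) (factor s (f 0) (h (suc n)) _)
  where
  factor : ∀ s a b c → a * (s * b) + s * c ≡ s * (a * b + c)
  factor = solve-∀ ℚ-ring

⋆-zeroˡ : ∀ h → 𝟘 ⋆ h ≗ 𝟘
⋆-zeroˡ h zero = *-zeroˡ (h 0)
⋆-zeroˡ h (suc n) = trans (cong₂ _+_ (*-zeroˡ (h (suc n))) (⋆-zeroˡ h n)) (+-identityʳ 0ℚ)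

⋆-identityˡ : ∀ h → 𝟙 ⋆ h ≗ h
⋆-identityˡ h zero = *-identityˡ (h 0)
⋆-identityˡ h (suc n) = trans (cong₂ _+_ (*-identityˡ (h (suc n))) (⋆-zeroˡ h n)) (+-identityʳ (h (suc n)))

⋆-assoc : ∀ f g h → (f ⋆ g) ⋆ h ≗ f ⋆ (g ⋆ h)
⋆-assoc f g h zero = *-assoc (f 0) (g 0) (h 0)
⋆-assoc f g h (suc n) = begin
  (f 0 * g 0) * h (suc n) + ((f 0 ∙ tail g ⊕ tail f ⋆ g) ⋆ h) n
    ≡⟨ cong ((f 0 * g 0) * h (suc n) +_) (trans (⋆-distribʳ-⊕ (f 0 ∙ tail g) (tail f ⋆ g) h n)
         (cong₂ _+_ (∙-⋆-assoc (f 0) (tail g) h n) (⋆-assoc (tail f) g h n))) ⟩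
  (f 0 * g 0) * h (suc n) + (f 0 * (tail g ⋆ h) n + (tail f ⋆ (g ⋆ h)) n)
    ≡⟨ factor (f 0) (g 0) (h (suc n)) _ _ ⟩
  f 0 * (g 0 * h (suc n) + (tail g ⋆ h) n) + (tail f ⋆ (g ⋆ h)) n ∎
  where
  open ≡-Reasoning
  factor : ∀ a b c x y → (a * b) * c + (a * x + y) ≡ a * (b * c + x) + y
  factor = solve-∀ ℚ-ring

⋆-as-sumBelow : ∀ f g n → (f ⋆ g) n ≡ sumBelow (suc n) (λ k → f k * g (n ∸ k))
⋆-as-sumBelow f g zero = sym (+-identityʳ _)
⋆-as-sumBelow f g (suc n) = cong (f 0 * g (suc n) +_) (⋆-as-sumBelow (tail f) g n)

sumBelow-⋆ : ∀ L (F : ℕ → Series) h → (λ j → sumBelow L (λ m → F m j)) ⋆ h ≗ λ n → sumBelow L (λ m → (F m ⋆ h) n)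
sumBelow-⋆ zero F h = ⋆-zeroˡ h
sumBelow-⋆ (suc L) F h n = trans (⋆-distribʳ-⊕ (F 0) (λ j → sumBelow L (λ m → F (suc m) j)) h n) (cong ((F 0 ⋆ h) n +_) (sumBelow-⋆ L (F ∘ suc) h n))

⋆-vanishes : ∀ {f} h n → h 0 ≡ 0ℚ → (∀ {k} → k < n → f k ≡ 0ℚ) → (f ⋆ h) n ≡ 0ℚ
⋆-vanishes {f} h zero h₀≡0 _ = trans (cong (f 0 *_) h₀≡0) (*-zeroʳ (f 0))
⋆-vanishes {f} h (suc n) h₀≡0 f≡0 = begin
  f 0 * h (suc n) + (tail f ⋆ h) n  ≡⟨ cong₂ _+_ (cong (_* h (suc n)) (f≡0 (s≤s z≤n))) (⋆-vanishes h n h₀≡0 (λ k<n → f≡0 (s≤s k<n))) ⟩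
  0ℚ * h (suc n) + 0ℚ               ≡⟨ trans (+-identityʳ _) (*-zeroˡ (h (suc n))) ⟩
  0ℚ                                ∎
  where open ≡-Reasoning

⋆-fixpoint-zero : ∀ r {u} h → h 0 ≡ 0ℚ → u ≗ r ∙ (u ⋆ h) → u ≗ 𝟘
⋆-fixpoint-zero r {u} h h₀≡0 u≗r∙u⋆h = <-rec (λ n → u n ≡ 0ℚ) λ n u<n≡0 →
  trans (u≗r∙u⋆h n) (trans (cong (r *_) (⋆-vanishes h n h₀≡0 u<n≡0)) (*-zeroʳ r))

reciprocal-zero : ∀ {a x} → a 0 ≡ 1ℚ → a ⋆ x ≗ 𝟙 → x 0 ≡ 1ℚ
reciprocal-zero {a} {x} a₀≡1 a⋆x≗𝟙 = trans (sym (*-identityˡ (x 0))) (trans (cong (_* x 0) (sym a₀≡1)) (a⋆x≗𝟙 0))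

reciprocal-suc : ∀ {a x} → a 0 ≡ 1ℚ → a ⋆ x ≗ 𝟙 → ∀ n → x (suc n) ≡ - (tail a ⋆ x) n
reciprocal-suc {a} {x} a₀≡1 a⋆x≗𝟙 n = begin
  x (suc n)                                     ≡⟨ isolate (x (suc n)) t ⟩
  (1ℚ * x (suc n) + t) + - t                    ≡⟨ cong (λ c → (c * x (suc n) + t) + - t) a₀≡1 ⟨
  (a ⋆ x) (suc n) + - t                         ≡⟨ cong (_+ - t) (a⋆x≗𝟙 (suc n)) ⟩
  0ℚ + - t                                      ≡⟨ +-identityˡ (- t) ⟩
  - t                                           ∎
  where
  open ≡-Reasoning
  t = (tail a ⋆ x) n
  isolate : ∀ y t → y ≡ (1ℚ * y + t) + - t
  isolate = solve-∀ ℚ-ring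

reciprocal-unique : ∀ {a x y} → a 0 ≡ 1ℚ → a ⋆ x ≗ 𝟙 → a ⋆ y ≗ 𝟙 → x ≗ y
reciprocal-unique {a} {x} {y} a₀≡1 a⋆x≗𝟙 a⋆y≗𝟙 = <-rec (λ n → x n ≡ y n) agree
  where
  agree : ∀ n → (∀ {k} → k < n → x k ≡ y k) → x n ≡ y n
  agree zero _ = trans (reciprocal-zero a₀≡1 a⋆x≗𝟙) (sym (reciprocal-zero a₀≡1 a⋆y≗𝟙))
  agree (suc n) x<n≡y = begin
    x (suc n)          ≡⟨ reciprocal-suc a₀≡1 a⋆x≗𝟙 n ⟩
    - (tail a ⋆ x) n   ≡⟨ cong -_ (⋆-congʳ-≤ (tail a) n (λ k k≤n → x<n≡y (s≤s k≤n))) ⟩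
    - (tail a ⋆ y) n   ≡⟨ reciprocal-suc a₀≡1 a⋆y≗𝟙 n ⟨
    y (suc n)          ∎
    where open ≡-Reasoning

-- The local convolution of invList has no name outside Defs; it is recovered
-- here by unification, after abstracting the literal 1 (and the zero test on a 0,
-- whose type mentions the same literal) so that the constraint is a pattern.
mutual
  invList-conv : Series → ℕ → ℕ → List ℚ → ℚ
  invList-conv a n = _

  invCoeff-suc-unfold : ∀ a n → invCoeff a (suc n) ≡ - (invList-conv a n 1 (invList a n) ÷' a 0)
  invCoeff-suc-unfold a n with a 0 ℚ.≟ 0ℚ | invList a n | 1
  ... | _ | ds | k = refl

invList-conv-≡-⋆ : ∀ a n j k → invList-conv a n k (invList a j) ≡ ((λ i → a (k ℕ.+ i)) ⋆ invCoeff a) j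
invList-conv-≡-⋆ a n zero k = trans (+-identityʳ _) (cong (λ m → a m * invCoeff a 0) (sym (ℕ.+-identityʳ k)))
invList-conv-≡-⋆ a n (suc j) k = cong₂ _+_
  (cong (λ m → a m * invCoeff a (suc j)) (sym (ℕ.+-identityʳ k)))
  (trans (invList-conv-≡-⋆ a n j (suc k)) (⋆-cong (λ i → cong a (sym (ℕ.+-suc k i))) (λ _ → refl) j))

⋆-invCoeff : ∀ a → a 0 ≡ 1ℚ → a ⋆ invCoeff a ≗ 𝟙
⋆-invCoeff a a₀≡1 zero = begin
  a 0 * (1ℚ ÷' a 0)  ≡⟨ cong (λ c → c * (1ℚ ÷' c)) a₀≡1 ⟩
  1ℚ * (1ℚ ÷' 1ℚ)    ≡⟨ *-identityˡ _ ⟩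
  1ℚ ÷' 1ℚ           ≡⟨ p÷'1≡p 1ℚ ⟩
  1ℚ                 ∎
  where open ≡-Reasoning
⋆-invCoeff a a₀≡1 (suc n) = begin
  a 0 * invCoeff a (suc n) + t   ≡⟨ cong (λ c → c * invCoeff a (suc n) + t) a₀≡1 ⟩
  1ℚ * invCoeff a (suc n) + t    ≡⟨ cong (λ y → 1ℚ * y + t) invCoeff-suc ⟩
  1ℚ * - t + t                   ≡⟨ cancel t ⟩
  0ℚ                             ∎
  where
  open ≡-Reasoning
  t = (tail a ⋆ invCoeff a) n
  invCoeff-suc : invCoeff a (suc n) ≡ - t
  invCoeff-suc = begin
    invCoeff a (suc n)                           ≡⟨ invCoeff-suc-unfold a n ⟩
    - (invList-conv a n 1 (invList a n) ÷' a 0)  ≡⟨ cong (λ c → - (invList-conv a n 1 (invList a n) ÷' c)) a₀≡1 ⟩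
    - (invList-conv a n 1 (invList a n) ÷' 1ℚ)   ≡⟨ cong -_ (p÷'1≡p _) ⟩
    - invList-conv a n 1 (invList a n)           ≡⟨ cong -_ (invList-conv-≡-⋆ a n n 1) ⟩
    - t                                          ∎
  cancel : ∀ t → 1ℚ * - t + t ≡ 0ℚ
  cancel = solve-∀ ℚ-ring

chainProduct : Series → ℕ → List ℕ → ℚ
chainProduct b prev [] = b prev
chainProduct b prev (j ∷ l) = b (prev ∸ j ℕ.+ 1) * chainProduct b j l

chainSum : Series → ℕ → Series
chainSum b m i = sumℚ (map (chainProduct b i) (decChains m i))

-- (b(x) − b₀ − b₁x) / x
higher : Series → Series
higher b zero = 0ℚ
higher b (suc d) = b (suc (suc d))

chainSum-zero : ∀ b → chainSum b 0 ≗ b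
chainSum-zero b i = +-identityʳ (b i)

chainSum-suc : ∀ b m → chainSum b (suc m) ≗ chainSum b m ⋆ higher b
chainSum-suc b m i = begin
  sumℚ (map (chainProduct b i) (concatMap (λ j → map (j ∷_) (decChains m j)) (upTo i)))
    ≡⟨ sumℚ-map-concatMap (chainProduct b i) (λ j → map (j ∷_) (decChains m j)) (upTo i) ⟩
  sumTo i (λ j → sumℚ (map (chainProduct b i) (map (j ∷_) (decChains m j))))
    ≡⟨ cong sumℚ (map-cong first-link (upTo i)) ⟩
  sumTo i (λ j → b (i ∸ j ℕ.+ 1) * chainSum b m j)
    ≡⟨ sumTo≡sumBelow i _ ⟩
  sumBelow i (λ j → b (i ∸ j ℕ.+ 1) * chainSum b m j)
    ≡⟨ sumBelow-cong i (λ j j<i → trans (*-comm _ (chainSum b m j)) (cong (chainSum b m j *_) (higher-∸ j<i))) ⟩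
  sumBelow i term
    ≡⟨ +-identityʳ _ ⟨
  sumBelow i term + 0ℚ
    ≡⟨ cong (sumBelow i term +_) (trans (cong (λ d → chainSum b m i * higher b d) (ℕ.n∸n≡0 i)) (*-zeroʳ (chainSum b m i))) ⟨
  sumBelow i term + term i
    ≡⟨ sumBelow-suc-last i term ⟨
  sumBelow (suc i) term
    ≡⟨ ⋆-as-sumBelow (chainSum b m) (higher b) i ⟨
  (chainSum b m ⋆ higher b) i ∎
  where
  open ≡-Reasoning
  term : ℕ → ℚ
  term k = chainSum b m k * higher b (i ∸ k)
  first-link : ∀ j → sumℚ (map (chainProduct b i) (map (j ∷_) (decChains m j))) ≡ b (i ∸ j ℕ.+ 1) * chainSum b m j
  first-link j = trans (cong sumℚ (sym (map-∘ (decChains m j))))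
                       (sym (*-distribˡ-sumℚ-map (b (i ∸ j ℕ.+ 1)) (chainProduct b j) (decChains m j)))
  higher-∸ : ∀ {j} → j < i → b (i ∸ j ℕ.+ 1) ≡ higher b (i ∸ j)
  higher-∸ {j} j<i with i ∸ j | ℕ.m<n⇒0<n∸m j<i
  ... | suc d | _ = cong b (ℕ.+-comm (suc d) 1)

geometricSumBelow : ℚ → (ℕ → Series) → ℕ → Series
geometricSumBelow r T L i = sumBelow L (λ m → (r ^ℚ m) * T m i)

geometricSum : ℚ → (ℕ → Series) → Series
geometricSum r T i = geometricSumBelow r T (suc i) i

module _ (r : ℚ) {T : ℕ → Series} {h : Series} (h₀≡0 : h 0 ≡ 0ℚ) (T-suc : ∀ m → T (suc m) ≗ T m ⋆ h) where

  powers-vanish : ∀ m {i} → i < m → T m i ≡ 0ℚ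
  powers-vanish (suc m) {i} (s≤s i≤m) = trans (T-suc m i)
    (⋆-vanishes h i h₀≡0 (λ k<i → powers-vanish m (ℕ.<-≤-trans k<i i≤m)))

  geometricSumBelow-stable : ∀ L i → suc i ≤ L → geometricSumBelow r T L i ≡ geometricSum r T i
  geometricSumBelow-stable L i i<L = begin
    sumBelow L term                                       ≡⟨ cong (λ K → sumBelow K term) (ℕ.m+[n∸m]≡n i<L) ⟨
    sumBelow (suc i ℕ.+ (L ∸ suc i)) term                 ≡⟨ sumBelow-+ (suc i) (L ∸ suc i) term ⟩
    sumBelow (suc i) term + sumBelow (L ∸ suc i) (λ k → term (suc i ℕ.+ k))
      ≡⟨ cong (sumBelow (suc i) term +_) (sumBelow-zero (L ∸ suc i) (λ k _ → high-term-vanishes k)) ⟩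
    sumBelow (suc i) term + 0ℚ                            ≡⟨ +-identityʳ _ ⟩
    sumBelow (suc i) term                                 ∎
    where
    open ≡-Reasoning
    term : ℕ → ℚ
    term m = (r ^ℚ m) * T m i
    high-term-vanishes : ∀ k → term (suc i ℕ.+ k) ≡ 0ℚ
    high-term-vanishes k = trans (cong ((r ^ℚ (suc i ℕ.+ k)) *_) (powers-vanish (suc i ℕ.+ k) (ℕ.m≤m+n (suc i) k))) (*-zeroʳ (r ^ℚ (suc i ℕ.+ k)))

  geometricSumBelow-suc : ∀ L → geometricSumBelow r T (suc L) ≗ T 0 ⊕ r ∙ (geometricSumBelow r T L ⋆ h)
  geometricSumBelow-suc L i = cong₂ _+_ (*-identityˡ (T 0 i)) (begin
    sumBelow L (λ m → (r * (r ^ℚ m)) * T (suc m) i)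
      ≡⟨ sumBelow-cong L (λ m _ → trans (cong ((r * (r ^ℚ m)) *_) (T-suc m i)) (trans (*-assoc r _ _) (cong (r *_) (sym (∙-⋆-assoc (r ^ℚ m) (T m) h i))))) ⟩
    sumBelow L (λ m → r * ((r ^ℚ m) ∙ T m ⋆ h) i)      ≡⟨ *-distribˡ-sumBelow L r _ ⟨
    r * sumBelow L (λ m → ((r ^ℚ m) ∙ T m ⋆ h) i)      ≡⟨ cong (r *_) (sumBelow-⋆ L (λ m → (r ^ℚ m) ∙ T m) h i) ⟨
    r * (geometricSumBelow r T L ⋆ h) i                ∎)
    where open ≡-Reasoning

  geometricSum-fixpoint : geometricSum r T ≗ T 0 ⊕ r ∙ (geometricSum r T ⋆ h)
  geometricSum-fixpoint i = begin
    geometricSum r T i                                        ≡⟨ geometricSumBelow-stable (2 ℕ.+ i) i (ℕ.n≤1+n (suc i)) ⟨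
    geometricSumBelow r T (2 ℕ.+ i) i                         ≡⟨ geometricSumBelow-suc (suc i) i ⟩
    T 0 i + r * (geometricSumBelow r T (suc i) ⋆ h) i
      ≡⟨ cong (λ x → T 0 i + r * x) (⋆-congˡ-≤ h i (λ k k≤i → geometricSumBelow-stable (suc i) k (s≤s k≤i))) ⟩
    T 0 i + r * (geometricSum r T ⋆ h) i                      ∎
    where open ≡-Reasoning

invCoeff-shift : ∀ {a A r} → a 0 ≡ 1ℚ → r * a 1 ≡ 1ℚ → A ≗ r ∙ tail a →
  invCoeff A ≗ geometricSum r (chainSum (invCoeff a))
invCoeff-shift {a} {A} {r} a₀≡1 r*a₁≡1 A≗r∙tail-a =
  reciprocal-unique A₀≡1 (⋆-invCoeff A A₀≡1) A⋆S≗𝟙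
  where
  open ≡-Reasoning
  b h S P U : Series
  b = invCoeff a
  h = higher b
  S = geometricSum r (chainSum b)
  P = tail a ⋆ S
  U = r ∙ P ⊕ (- 1ℚ) ∙ 𝟙

  A₀≡1 : A 0 ≡ 1ℚ
  A₀≡1 = trans (A≗r∙tail-a 0) r*a₁≡1

  S-fixpoint : S ≗ b ⊕ r ∙ (S ⋆ h)
  S-fixpoint i = trans (geometricSum-fixpoint r refl (chainSum-suc b) i) (cong (_+ r * (S ⋆ h) i) (chainSum-zero b i))

  tail-a⋆b : ∀ n → (tail a ⋆ b) n ≡ - b (suc n)
  tail-a⋆b n = trans (negate-twice _) (cong -_ (sym (reciprocal-suc a₀≡1 (⋆-invCoeff a a₀≡1) n)))
    where
    negate-twice : ∀ x → x ≡ - (- x)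
    negate-twice = solve-∀ ℚ-ring

  tail-b : tail b ≗ h ⊕ b 1 ∙ 𝟙
  tail-b zero = sym (trans (+-identityˡ _) (*-identityʳ (b 1)))
  tail-b (suc n) = sym (trans (cong (b (2 ℕ.+ n) +_) (*-zeroʳ (b 1))) (+-identityʳ _))

  r*b₁≡-1 : r * b 1 ≡ - 1ℚ
  r*b₁≡-1 = begin
    r * b 1               ≡⟨ cong (r *_) (reciprocal-suc a₀≡1 (⋆-invCoeff a a₀≡1) 0) ⟩
    r * - (a 1 * b 0)     ≡⟨ cong (λ x → r * - (a 1 * x)) (reciprocal-zero a₀≡1 (⋆-invCoeff a a₀≡1)) ⟩
    r * - (a 1 * 1ℚ)      ≡⟨ pull-out r (a 1) ⟩
    - (r * a 1)           ≡⟨ cong -_ r*a₁≡1 ⟩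
    - 1ℚ                  ∎
    where
    pull-out : ∀ r a → r * - (a * 1ℚ) ≡ - (r * a)
    pull-out = solve-∀ ℚ-ring

  P-fixpoint : ∀ n → P n ≡ - b (suc n) + r * (P ⋆ h) n
  P-fixpoint n = begin
    (tail a ⋆ S) n                                        ≡⟨ ⋆-cong (λ _ → refl) S-fixpoint n ⟩
    (tail a ⋆ (b ⊕ r ∙ (S ⋆ h))) n                        ≡⟨ ⋆-distribˡ-⊕ (tail a) b (r ∙ (S ⋆ h)) n ⟩
    (tail a ⋆ b) n + (tail a ⋆ r ∙ (S ⋆ h)) n             ≡⟨ cong₂ _+_ (tail-a⋆b n) (⋆-∙-comm r (tail a) (S ⋆ h) n) ⟩
    - b (suc n) + r * (tail a ⋆ (S ⋆ h)) n                ≡⟨ cong (λ x → - b (suc n) + r * x) (⋆-assoc (tail a) S h n) ⟨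
    - b (suc n) + r * (P ⋆ h) n                           ∎

  U⋆h : ∀ n → (U ⋆ h) n ≡ r * (P ⋆ h) n + - 1ℚ * h n
  U⋆h n = trans (⋆-distribʳ-⊕ (r ∙ P) ((- 1ℚ) ∙ 𝟙) h n)
    (cong₂ _+_ (∙-⋆-assoc r P h n) (trans (∙-⋆-assoc (- 1ℚ) 𝟙 h n) (cong (- 1ℚ *_) (⋆-identityˡ h n))))

  U-fixpoint : U ≗ r ∙ (U ⋆ h)
  U-fixpoint n = begin
    r * P n + - 1ℚ * 𝟙 n
      ≡⟨ cong (λ x → r * x + - 1ℚ * 𝟙 n) (trans (P-fixpoint n) (cong (λ x → - x + r * (P ⋆ h) n) (tail-b n))) ⟩
    r * (- (h n + b 1 * 𝟙 n) + r * (P ⋆ h) n) + - 1ℚ * 𝟙 n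
      ≡⟨ expand r (h n) (b 1) (𝟙 n) ((P ⋆ h) n) ⟩
    r * (r * (P ⋆ h) n + - 1ℚ * h n) + - (r * b 1 + 1ℚ) * 𝟙 n
      ≡⟨ cong (λ x → r * (r * (P ⋆ h) n + - 1ℚ * h n) + - (x + 1ℚ) * 𝟙 n) r*b₁≡-1 ⟩
    r * (r * (P ⋆ h) n + - 1ℚ * h n) + - (- 1ℚ + 1ℚ) * 𝟙 n
      ≡⟨ drop-zero _ (𝟙 n) ⟩
    r * (r * (P ⋆ h) n + - 1ℚ * h n)
      ≡⟨ cong (r *_) (U⋆h n) ⟨
    r * (U ⋆ h) n ∎
    where
    expand : ∀ r h b₁ e y → r * (- (h + b₁ * e) + r * y) + - 1ℚ * e ≡ r * (r * y + - 1ℚ * h) + - (r * b₁ + 1ℚ) * e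
    expand = solve-∀ ℚ-ring
    drop-zero : ∀ x e → x + - (- 1ℚ + 1ℚ) * e ≡ x
    drop-zero = solve-∀ ℚ-ring

  A⋆S≗𝟙 : A ⋆ S ≗ 𝟙
  A⋆S≗𝟙 n = begin
    (A ⋆ S) n                    ≡⟨ ⋆-cong A≗r∙tail-a (λ _ → refl) n ⟩
    (r ∙ tail a ⋆ S) n           ≡⟨ ∙-⋆-assoc r (tail a) S n ⟩
    r * P n                      ≡⟨ solve-for-rP (r * P n) (𝟙 n) ⟩
    U n + 𝟙 n                    ≡⟨ cong (_+ 𝟙 n) (⋆-fixpoint-zero r h refl U-fixpoint n) ⟩
    0ℚ + 𝟙 n                     ≡⟨ +-identityˡ (𝟙 n) ⟩
    𝟙 n                          ∎
    where
    solve-for-rP : ∀ x e → x ≡ (x + - 1ℚ * e) + e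
    solve-for-rP = solve-∀ ℚ-ring

rising-1 : ∀ n → rising 1 n ≡ n !
rising-1 zero = refl
rising-1 (suc n) = trans (cong (ℕ._* suc n) (rising-1 n)) (ℕ.*-comm (n !) (suc n))

rising-nonZero : ∀ N n → ℕ.NonZero (rising (suc N) n)
rising-nonZero N zero = _
rising-nonZero N (suc n) = ℕ.m*n≢0 (rising (suc N) n) (suc N ℕ.+ n) {{rising-nonZero N n}}

rising-*-last : ∀ N n → rising N n ℕ.* (N ℕ.+ n) ≡ N ℕ.* rising (suc N) n
rising-*-last N zero = trans (ℕ.*-identityˡ (N ℕ.+ 0)) (trans (ℕ.+-identityʳ N) (sym (ℕ.*-identityʳ N)))
rising-*-last N (suc n) = begin
  rising N n ℕ.* (N ℕ.+ n) ℕ.* (N ℕ.+ suc n)  ≡⟨ cong₂ ℕ._*_ (rising-*-last N n) (ℕ.+-suc N n) ⟩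
  N ℕ.* rising (suc N) n ℕ.* (suc N ℕ.+ n)    ≡⟨ ℕ.*-assoc N _ _ ⟩
  N ℕ.* rising (suc N) (suc n)                ∎
  where open ≡-Reasoning

F21coeff-1-N-suc-N : ∀ M n → let N = suc M in
  F21coeff 1 N (suc N) n ≡ ℕtoℚ N ÷' ℕtoℚ (N ℕ.+ n)
F21coeff-1-N-suc-N M n = ÷'-cross
  (ℕtoℚ-≢0 (rising (suc N) n ℕ.* n !) {{ℕ.m*n≢0 _ _ {{rising-nonZero N n}} {{n !≢0}}}})
  (ℕtoℚ-≢0 (N ℕ.+ n))
  (begin
    ℕtoℚ (rising 1 n ℕ.* rising N n) * ℕtoℚ (N ℕ.+ n)  ≡⟨ ℕtoℚ-homo-* (rising 1 n ℕ.* rising N n) (N ℕ.+ n) ⟨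
    ℕtoℚ (rising 1 n ℕ.* rising N n ℕ.* (N ℕ.+ n))    ≡⟨ cong ℕtoℚ numerator ⟩
    ℕtoℚ (N ℕ.* (rising (suc N) n ℕ.* n !))           ≡⟨ ℕtoℚ-homo-* N (rising (suc N) n ℕ.* n !) ⟩
    ℕtoℚ N * ℕtoℚ (rising (suc N) n ℕ.* n !)          ∎)
  where
  open ≡-Reasoning
  N = suc M
  numerator : rising 1 n ℕ.* rising N n ℕ.* (N ℕ.+ n) ≡ N ℕ.* (rising (suc N) n ℕ.* n !)
  numerator = begin
    rising 1 n ℕ.* rising N n ℕ.* (N ℕ.+ n)    ≡⟨ ℕ.*-assoc (rising 1 n) _ _ ⟩
    rising 1 n ℕ.* (rising N n ℕ.* (N ℕ.+ n))  ≡⟨ cong₂ ℕ._*_ (rising-1 n) (rising-*-last N n) ⟩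
    n ! ℕ.* (N ℕ.* rising (suc N) n)           ≡⟨ rotate (n !) N _ ⟩
    N ℕ.* (rising (suc N) n ℕ.* n !)           ∎
    where
    rotate : ∀ a b c → a ℕ.* (b ℕ.* c) ≡ b ℕ.* (c ℕ.* a)
    rotate = ℕ-Solver.solve-∀

ρ : ℕ → ℚ
ρ N = ℕtoℚ N ÷' (1ℚ - ℕtoℚ N)

ρ-*-pred : ∀ K → ρ (2 ℕ.+ K) * ℕtoℚ (suc K) ≡ - ℕtoℚ (2 ℕ.+ K)
ρ-*-pred K = begin
  r * M              ≡⟨ flip r M ⟩
  - (r * - M)        ≡⟨ cong (λ x → - (r * x)) 1-N≡-M ⟨
  - (r * (1ℚ - N))   ≡⟨ cong -_ (p÷'q*q≡p N 1-N≢0) ⟩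
  - N                ∎
  where
  open ≡-Reasoning
  r = ρ (2 ℕ.+ K)
  N = ℕtoℚ (2 ℕ.+ K)
  M = ℕtoℚ (suc K)
  flip : ∀ x y → x * y ≡ - (x * - y)
  flip = solve-∀ ℚ-ring
  1-N≡-M : 1ℚ - N ≡ - M
  1-N≡-M = trans (cong (λ x → 1ℚ - x) (ℕtoℚ-homo-+ 1 (suc K))) (cancel M)
    where
    cancel : ∀ x → 1ℚ - (1ℚ + x) ≡ - x
    cancel = solve-∀ ℚ-ring
  1-N≢0 : 1ℚ - N ≢ 0ℚ
  1-N≢0 eq = ℕtoℚ-≢0 (suc K) (neg-injective (trans (sym 1-N≡-M) eq))

hypCoeff-shift : ∀ K n → hypCoeff (2 ℕ.+ K) n ≡ ρ (2 ℕ.+ K) * hypCoeff (suc K) (suc n)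
hypCoeff-shift K n = sym (begin
  ρ N * hypCoeff (suc K) (suc n)                     ≡⟨ cong (λ x → ρ N * (x * (- 1ℚ * s))) (F21coeff-1-N-suc-N K (suc n)) ⟩
  ρ N * ((M ÷' ℕtoℚ (suc K ℕ.+ suc n)) * (- 1ℚ * s)) ≡⟨ cong (λ d → ρ N * ((M ÷' ℕtoℚ d) * (- 1ℚ * s))) (ℕ.+-suc (suc K) n) ⟩
  ρ N * ((M ÷' D) * (- 1ℚ * s))                      ≡⟨ cong (λ x → ρ N * (x * (- 1ℚ * s))) (÷'-≡-*1/ M D≢0) ⟩
  ρ N * ((M * 1/D) * (- 1ℚ * s))                     ≡⟨ regroup (ρ N) M 1/D s ⟩
  (ρ N * M) * (- 1ℚ * 1/D * s)                       ≡⟨ cong (λ x → x * (- 1ℚ * 1/D * s)) (ρ-*-pred K) ⟩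
  (- ℕtoℚ N) * (- 1ℚ * 1/D * s)                      ≡⟨ cancel-signs (ℕtoℚ N) 1/D s ⟩
  ℕtoℚ N * 1/D * s                                   ≡⟨ cong (_* s) (÷'-≡-*1/ (ℕtoℚ N) D≢0) ⟨
  (ℕtoℚ N ÷' D) * s                                  ≡⟨ cong (_* s) (F21coeff-1-N-suc-N (suc K) n) ⟨
  hypCoeff N n                                       ∎)
  where
  open ≡-Reasoning
  N = 2 ℕ.+ K
  M = ℕtoℚ (suc K)
  D = ℕtoℚ (N ℕ.+ n)
  D≢0 = ℕtoℚ-≢0 (N ℕ.+ n)
  1/D = (1/ D) {{≢-nonZero D≢0}}
  s = (- 1ℚ) ^ℚ n
  regroup : ∀ r m i s → r * ((m * i) * (- 1ℚ * s)) ≡ (r * m) * (- 1ℚ * i * s)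
  regroup = solve-∀ ℚ-ring
  cancel-signs : ∀ n i s → (- n) * (- 1ℚ * i * s) ≡ n * i * s
  cancel-signs = solve-∀ ℚ-ring

chainTerm-≡ : ∀ N n prev l → chainTerm N n prev l ≡ ℕtoℚ (n !) * chainProduct (invCoeff (hypCoeff (N ∸ 1))) prev l
chainTerm-≡ N n prev [] = begin
  (ℕtoℚ (n !) ÷' ℕtoℚ (prev !)) * (ℕtoℚ (prev !) * b prev)  ≡⟨ *-assoc (ℕtoℚ (n !) ÷' ℕtoℚ (prev !)) (ℕtoℚ (prev !)) (b prev) ⟨
  (ℕtoℚ (n !) ÷' ℕtoℚ (prev !)) * ℕtoℚ (prev !) * b prev    ≡⟨ cong (_* b prev) (p÷'q*q≡p (ℕtoℚ (n !)) (ℕtoℚ-≢0 (prev !) {{prev !≢0}})) ⟩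
  ℕtoℚ (n !) * b prev                                        ∎
  where
  open ≡-Reasoning
  b = invCoeff (hypCoeff (N ∸ 1))
chainTerm-≡ N n prev (j ∷ l) = begin
  (c (N ∸ 1) k ÷' ℕtoℚ (k !)) * chainTerm N n j l            ≡⟨ cong₂ _*_ c÷'k!≡b (chainTerm-≡ N n j l) ⟩
  b k * (ℕtoℚ (n !) * chainProduct b j l)                    ≡⟨ swap (b k) (ℕtoℚ (n !)) _ ⟩
  ℕtoℚ (n !) * (b k * chainProduct b j l)                    ∎
  where
  open ≡-Reasoning
  b = invCoeff (hypCoeff (N ∸ 1))
  k = prev ∸ j ℕ.+ 1
  c÷'k!≡b : c (N ∸ 1) k ÷' ℕtoℚ (k !) ≡ b k
  c÷'k!≡b = ÷'-unique (b k) (ℕtoℚ-≢0 (k !) {{k !≢0}}) (*-comm (b k) (ℕtoℚ (k !)))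
  swap : ∀ x y z → x * (y * z) ≡ y * (x * z)
  swap = solve-∀ ℚ-ring

proposition1 : (N n : ℕ) → 2 ≤ N → 1 ≤ n →
    c N n ≡ sumTo (suc n) (λ m → ((ℕtoℚ N ÷' (1ℚ - ℕtoℚ N)) ^ℚ m) * sumℚ (map (chainTerm N n n) (decChains m n)))
proposition1 N@(suc (suc K)) n _ _ = begin
  ℕtoℚ (n !) * invCoeff (hypCoeff N) n
    ≡⟨ cong (ℕtoℚ (n !) *_) (invCoeff-shift {r = ρ N} refl (sym (hypCoeff-shift K 0)) (hypCoeff-shift K) n) ⟩
  ℕtoℚ (n !) * sumBelow (suc n) (λ m → (ρ N ^ℚ m) * chainSum b m n)
    ≡⟨ *-distribˡ-sumBelow (suc n) (ℕtoℚ (n !)) (λ m → (ρ N ^ℚ m) * chainSum b m n) ⟩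
  sumBelow (suc n) (λ m → ℕtoℚ (n !) * ((ρ N ^ℚ m) * chainSum b m n))
    ≡⟨ sumBelow-cong (suc n) (λ m _ → trans (swap (ℕtoℚ (n !)) (ρ N ^ℚ m) (chainSum b m n)) (cong ((ρ N ^ℚ m) *_) (chainTerms m))) ⟩
  sumBelow (suc n) (λ m → (ρ N ^ℚ m) * sumℚ (map (chainTerm N n n) (decChains m n)))
    ≡⟨ sumTo≡sumBelow (suc n) (λ m → (ρ N ^ℚ m) * sumℚ (map (chainTerm N n n) (decChains m n))) ⟨
  sumTo (suc n) (λ m → (ρ N ^ℚ m) * sumℚ (map (chainTerm N n n) (decChains m n))) ∎
  where
  open ≡-Reasoning
  b = invCoeff (hypCoeff (suc K))
  swap : ∀ x y z → x * (y * z) ≡ y * (x * z)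
  swap = solve-∀ ℚ-ring
  chainTerms : ∀ m → ℕtoℚ (n !) * chainSum b m n ≡ sumℚ (map (chainTerm N n n) (decChains m n))
  chainTerms m = trans (*-distribˡ-sumℚ-map (ℕtoℚ (n !)) (chainProduct b n) (decChains m n))
                       (cong sumℚ (map-cong (λ l → sym (chainTerm-≡ N n n l)) (decChains m n)))
proposition1 (suc zero) n (s≤s ()) _
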